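{- If $G$ is a monochromatic $2$-connected $P_4$-free graph of order at least $9$, then $pc_{opt}(G)\le 5$.
   Context: All graphs are finite and simple. A graph is $P_4$-free if it contains no induced subgraph isomorphic to the path $P_4$. An edge-colored graph is properly colored if no two adjacent edges share a color; an edge-colored connected graph is properly connected if between every pair of distinct vertices there is a properly colored path. A monochromatic graph is one in which every edge has color $0$; any color $i\neq 0$ is a new color. For a monochromatic connected graph $G$, $pc_{opt}(G)$ is the minimum of $p+q$ over all ways to make $G$ properly connected by recoloring $p$ edges of $G$ using $q$ new colors. -}

module Defs where

open import Data.Nat using (ℕ; zero; suc; _+_; _≤_; _<ᵇ_)
open import Data.Fin using (Fin; toℕ)
open import Data.Bool using (Bool; true; false; _∧_; not)
open import Data.List using (List; []; _∷_; head; last; length; filterᵇ; concatMap; allFin)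
open import Data.List.Relation.Unary.Unique.Propositional using (Unique)
open import Data.List.Membership.Propositional using (_∉_)
open import Data.Maybe using (just)
open import Data.Product using (Σ; _×_; _,_; ∃; ∃-syntax)
open import Data.Unit using (⊤)
open import Relation.Binary.PropositionalEquality using (_≡_; _≢_)
open import Relation.Nullary using (¬_)

record Graph : Set where
  field
    n      : ℕ
    adj    : Fin n → Fin n → Bool
    sym    : ∀ i j → adj i j ≡ adj j i
    irrefl : ∀ i → adj i i ≡ false

open Graph public

Adj : (G : Graph) → Fin (n G) → Fin (n G) → Set
Adj G i j = adj G i j ≡ true

order : Graph → ℕ
order G = n G

Consec : {A : Set} → (A → A → Set) → List A → Set
Consec R []           = ⊤
Consec R (x ∷ [])     = ⊤
Consec R (x ∷ y ∷ xs) = R x y × Consec R (y ∷ xs)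

Consec3 : {A : Set} → (A → A → A → Set) → List A → Set
Consec3 R []               = ⊤
Consec3 R (x ∷ [])         = ⊤
Consec3 R (x ∷ y ∷ [])     = ⊤
Consec3 R (x ∷ y ∷ z ∷ xs) = R x y z × Consec3 R (y ∷ z ∷ xs)

IsPath : (G : Graph) → Fin (n G) → Fin (n G) → List (Fin (n G)) → Set
IsPath G u v vs = head vs ≡ just u × last vs ≡ just v × Unique vs × Consec (Adj G) vs

Connected : Graph → Set
Connected G = ∀ u v → ∃[ vs ] IsPath G u v vs

TwoConnected : Graph → Set
TwoConnected G =
  3 ≤ order G × Connected G ×
  (∀ w u v → u ≢ w → v ≢ w → ∃[ vs ] (IsPath G u v vs × w ∉ vs))

P4Free : Graph → Set
P4Free G = ∀ a b c d →
  ¬ (a ≢ b × a ≢ c × a ≢ d × b ≢ c × b ≢ d × c ≢ d ×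
     Adj G a b × Adj G b c × Adj G c d ×
     adj G a c ≡ false × adj G a d ≡ false × adj G b d ≡ false)

-- An edge colouring using colour 0 (the original colour) and new colours
-- 1 .. q; only the values on edges are meaningful.
record Colouring (G : Graph) (q : ℕ) : Set where
  field
    col    : Fin (n G) → Fin (n G) → Fin (suc q)
    colSym : ∀ i j → col i j ≡ col j i

open Colouring public

isNonZero : {k : ℕ} → Fin k → Bool
isNonZero Fin.zero    = false
isNonZero (Fin.suc _) = true

pairs : (m : ℕ) → List (Fin m × Fin m)
pairs m = concatMap (λ i → filterᵇ (λ p → toℕ (Data.Product.proj₁ p) <ᵇ toℕ (Data.Product.proj₂ p))
                                     (Data.List.map (λ j → (i , j)) (allFin m)))
                    (allFin m)

recoloured : {G : Graph} {q : ℕ} → Colouring G q → ℕ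
recoloured {G} c =
  length (filterᵇ (λ p → adj G (Data.Product.proj₁ p) (Data.Product.proj₂ p)
                         ∧ isNonZero (col c (Data.Product.proj₁ p) (Data.Product.proj₂ p)))
                  (pairs (n G)))

ProperlyColouredPath : {G : Graph} {q : ℕ} → Colouring G q →
                       Fin (n G) → Fin (n G) → List (Fin (n G)) → Set
ProperlyColouredPath {G} c u v vs =
  IsPath G u v vs × Consec3 (λ x y z → col c x y ≢ col c y z) vs

ProperlyConnected : {G : Graph} {q : ℕ} → Colouring G q → Set
ProperlyConnected {G} c = ∀ u v → u ≢ v → ∃[ vs ] ProperlyColouredPath c u v vs

-- pc_opt(G) ≤ k : G (monochromatic, colour 0) can be made properly connected
-- by recolouring p edges with (at most) q new colours, p + q ≤ k.
PcOptAtMost : Graph → ℕ → Set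
PcOptAtMost G k = ∃[ q ] Σ (Colouring G q) λ c → ProperlyConnected c × recoloured c + q ≤ k

-- A 2-connected P₄-free graph G of order at least 9 has pc_opt(G) ≤ 5; the
-- argument below works for every order ≥ 4.
--
-- Cograph decomposition (decompose): on two or more vertices a symmetric
-- P₄-free relation or its complement is disconnected.  It is proved by adding
-- vertices one at a time and passing to the complement, which is again P₄-free.
-- Hence a connected P₄-free graph is a join A + B (joinSplit).  If both classes
-- have two vertices a₁, a₂ ∈ A and b₁, b₂ ∈ B, recolour a₁b₁ with colour 1 and
-- a₁b₂, a₂b₁ with colour 2: three edges, two colours, and two vertices of one
-- class are joined by a properly coloured path of length 2 or 4 through the
-- other class (balancedJoin⇒pcOpt≤5).  If a class is a single vertex d, then d
-- dominates G, G - d is connected by 2-connectivity and hence a join X + Y, and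
-- adding d to one of X, Y gives two vertices in each class (dominatingCase).

module Submission where

open import Defs hiding (sym)
open import Data.Nat using (ℕ; _+_; _≤_; _<_; _<ᵇ_; s≤s; z≤n)
open import Data.Nat.Properties using (<⇒≱; <⇒≯; <ᵇ⇒<; <⇒<ᵇ; +-monoˡ-≤; ≤-trans; n≤1+n)
open import Data.Fin using (Fin; zero; suc; toℕ)
open import Data.Maybe using (just)
open import Data.Fin.Properties using (_≟_; any?; all?; injective⇒≤)
open import Data.Bool using (Bool; true; false; not; _∧_; if_then_else_; T)
open import Data.Bool.Properties using (¬-not; not-involutive; T-≡) renaming (_≟_ to _≟ᵇ_)
open import Data.List using (List; []; _∷_; length; lookup; last; filter; filterᵇ; map; allFin)
open import Data.List.Relation.Unary.All as All using (All; _∷_; [])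
import Data.List.Relation.Unary.All.Properties as All
import Data.List.Relation.Unary.AllPairs as AllPairs
import Data.List.Relation.Unary.AllPairs.Properties as AllPairs
open import Data.List.Relation.Unary.Any as Any using (here; there; index)
open import Data.List.Relation.Unary.AllPairs using (_∷_; [])
open import Data.List.Relation.Unary.Unique.Propositional using (Unique)
open import Data.List.Relation.Unary.Unique.Propositional.Properties using (Unique[x∷xs]⇒x∉xs; filter⁺; allFin⁺; map⁺; concat⁺)
open import Data.List.Membership.Propositional using (_∈_; _∉_; find; lose)
open import Data.List.Membership.Propositional.Properties using (∈-lookup; ∈-filter⁺; ∈-filter⁻; ∈-allFin; ∈-map⁻; ∈-concatMap⁻)
open import Data.List.Membership.Setoid.Properties using (index-injective)
import Data.List.Membership.DecPropositional as DecMembership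
open import Data.Product using (_×_; _,_; ∃; proj₁; proj₂)
open import Data.Sum using (_⊎_; inj₁; inj₂; [_,_])
open import Data.Empty using (⊥-elim)
open import Data.Unit using (tt)
open import Function using (_∘_; Equivalence)
open import Relation.Binary.PropositionalEquality
  using (_≡_; _≢_; refl; sym; trans; cong; cong₂; subst; subst₂; setoid)
open import Relation.Nullary using (¬_; yes; no; does; contradiction)
open import Relation.Nullary.Decidable using (dec-true; dec-false; decidable-stable; ¬?; _×-dec_; _→-dec_; T?; toWitness)
open import Relation.Unary using (Decidable)

lookup-injective : {A : Set} {xs : List A} → Unique xs →
                   ∀ {i j} → lookup xs i ≡ lookup xs j → i ≡ j
lookup-injective (_ ∷ _)       {zero}  {zero}  _  = refl
lookup-injective (x∉xs ∷ _)    {zero}  {suc j} eq = ⊥-elim (All.lookup x∉xs (∈-lookup j) eq)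
lookup-injective (x∉xs ∷ _)    {suc i} {zero}  eq = ⊥-elim (All.lookup x∉xs (∈-lookup i) (sym eq))
lookup-injective (_ ∷ unique)  {suc i} {suc j} eq = cong suc (lookup-injective unique eq)

unique-⊆⇒length≤ : {A : Set} {xs S : List A} → Unique xs → All (_∈ S) xs → length xs ≤ length S
unique-⊆⇒length≤ {A} {xs} unique xs⊆S = injective⇒≤ {f = position} position-injective
  where
  position : Fin (length xs) → Fin _
  position i = index (All.lookup xs⊆S (∈-lookup i))
  position-injective : ∀ {i j} → position i ≡ position j → i ≡ j
  position-injective eq = lookup-injective unique (index-injective (setoid A) _ _ eq)

module _ {m : ℕ} where
  open DecMembership (_≟_ {m}) using (_∈?_)

  missingVertex : (xs : List (Fin m)) → length xs < m → ∃ λ z → z ∉ xs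
  missingVertex xs short with any? (λ z → ¬? (z ∈? xs))
  ... | yes found = found
  ... | no none   = contradiction (injective⇒≤ {f = position} position-injective) (<⇒≱ short)
    where
    member : ∀ z → z ∈ xs
    member z = decidable-stable (z ∈? xs) (λ z∉xs → none (z , z∉xs))
    position : Fin m → Fin (length xs)
    position z = index (member z)
    position-injective : ∀ {y z} → position y ≡ position z → y ≡ z
    position-injective eq = index-injective (setoid (Fin m)) (member _) (member _) eq

twoMissing : ∀ {m} (xs : List (Fin m)) → 2 + length xs ≤ m →
             ∃ λ z₁ → ∃ λ z₂ → z₁ ∉ xs × z₂ ∉ xs × z₁ ≢ z₂
twoMissing xs room with missingVertex xs (≤-trans (n≤1+n _) room)
... | z₁ , z₁∉ with missingVertex (z₁ ∷ xs) room
...   | z₂ , z₂∉ = z₁ , z₂ , z₁∉ , z₂∉ ∘ there , λ z₁≡z₂ → z₂∉ (here (sym z₁≡z₂))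

secondOrSole : ∀ {m} {P : Fin m → Set} → Decidable P → (x₀ : Fin m) →
               (∃ λ x → P x × x ≢ x₀) ⊎ (∀ x → P x → x ≡ x₀)
secondOrSole P? x₀ with any? (λ x → P? x ×-dec ¬? (x ≟ x₀))
... | yes (x , px , x≢x₀) = inj₁ (x , px , x≢x₀)
... | no none = inj₂ λ x px → decidable-stable (x ≟ x₀) (λ x≢x₀ → none (x , px , x≢x₀))

BRel : ℕ → Set
BRel m = Fin m → Fin m → Bool

SymmetricRel : ∀ {m} → BRel m → Set
SymmetricRel r = ∀ i j → r i j ≡ r j i

InducedP4Free : ∀ {m} → BRel m → Set
InducedP4Free {m} r = ∀ (a b c d : Fin m) → ¬ (a ≢ b × a ≢ c × a ≢ d × b ≢ c × b ≢ d × c ≢ d ×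
  r a b ≡ true × r b c ≡ true × r c d ≡ true × r a c ≡ false × r a d ≡ false × r b d ≡ false)

-- the complementary relation (the diagonal is irrelevant throughout)
complement : ∀ {m} → BRel m → BRel m
complement r i j = not (r i j)

not-flip : ∀ {b c} → not b ≡ c → b ≡ not c
not-flip {b} eq = trans (sym (not-involutive b)) (cong not eq)

∧-true : ∀ {a c} → a ∧ c ≡ true → a ≡ true × c ≡ true
∧-true {true} c≡true = refl , c≡true

separates : ∀ {A : Set} (f : A → Bool) {x y} → f x ≡ true → f y ≡ false → x ≢ y
separates f fx fy refl with () ← trans (sym fx) fy

complement-symmetric : ∀ {m} {r : BRel m} → SymmetricRel r → SymmetricRel (complement r)
complement-symmetric sym-r i j = cong not (sym-r i j)

-- (the complement of an induced path a–b–c–d is the induced path c–a–d–b)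
complement-P4Free : ∀ {m} {r : BRel m} → SymmetricRel r → InducedP4Free r → InducedP4Free (complement r)
complement-P4Free sym-r p4 a b c d
  (a≢b , a≢c , a≢d , b≢c , b≢d , c≢d , ab , bc , cd , ¬ac , ¬ad , ¬bd) =
  p4 c a d b ( a≢c ∘ sym , c≢d , b≢c ∘ sym , a≢d , a≢b , b≢d ∘ sym
             , trans (sym-r c a) (not-flip ¬ac) , not-flip ¬ad , trans (sym-r d b) (not-flip ¬bd)
             , not-flip cd , trans (sym-r c b) (not-flip bc) , not-flip ab )

-- For b = false the relation is disconnected on L, for b = true its complement is.
record Split {m} (r : BRel m) (L : List (Fin m)) (b : Bool) : Set where
  constructor split
  field
    side       : Fin m → Bool
    trueWit    : ∃ λ x → x ∈ L × side x ≡ true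
    falseWit   : ∃ λ y → y ∈ L × side y ≡ false
    across     : ∀ {x y} → x ∈ L → y ∈ L → side x ≡ true → side y ≡ false → r x y ≡ b

open Split

assign : ∀ {m} → Fin m → Bool → (Fin m → Bool) → Fin m → Bool
assign v bv s z = if does (z ≟ v) then bv else s z

assign-self : ∀ {m} (v : Fin m) bv s → assign v bv s v ≡ bv
assign-self v bv s rewrite dec-true (v ≟ v) refl = refl

assign-other : ∀ {m} {v : Fin m} bv s {z} → z ≢ v → assign v bv s z ≡ s z
assign-other {v = v} bv s {z} z≢v rewrite dec-false (z ≟ v) z≢v = refl

∉⇒≢ : ∀ {m} {v z : Fin m} {L : List (Fin m)} → v ∉ L → z ∈ L → z ≢ v
∉⇒≢ v∉L z∈L refl = v∉L z∈L

module _ {m : ℕ} {r : BRel m} where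

  toComplement : ∀ {L b} → Split r L b → Split (complement r) L (not b)
  toComplement (split s t f cr) = split s t f λ x∈ y∈ sx sy → cong not (cr x∈ y∈ sx sy)

  fromComplement : ∀ {L b} → Split (complement r) L b → Split r L (not b)
  fromComplement (split s t f cr) = split s t f λ x∈ y∈ sx sy → not-flip (cr x∈ y∈ sx sy)

  flipSides : SymmetricRel r → ∀ {L b} → Split r L b → Split r L b
  flipSides sym-r (split s (x , x∈ , sx) (y , y∈ , sy) cr) =
    split (not ∘ s) (y , y∈ , cong not sy) (x , x∈ , cong not sx)
          λ x∈ y∈ sx sy → trans (sym-r _ _) (cr y∈ x∈ (not-flip sy) (not-flip sx))

  insert : SymmetricRel r → ∀ {L b v} (sp : Split r L b) → v ∉ L → (bv : Bool) →
           (∀ {y} → y ∈ L → side sp y ≡ not bv → r v y ≡ b) → Split r (v ∷ L) b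
  insert sym-r {L} {b} {v} (split s (x , x∈ , sx) (y , y∈ , sy) cr) v∉L bv joins =
    split t (x , there x∈ , trans (keep x∈) sx) (y , there y∈ , trans (keep y∈) sy) cr′
    where
    t : Fin m → Bool
    t = assign v bv s
    keep : ∀ {z} → z ∈ L → t z ≡ s z
    keep z∈ = assign-other bv s (∉⇒≢ v∉L z∈)
    classOf : ∀ {z c} → z ∈ L → t z ≡ c → bv ≡ not c → s z ≡ not bv
    classOf {c = c} z∈ tz bv≡ = trans (sym (keep z∈)) (trans tz (trans (sym (not-involutive c)) (cong not (sym bv≡))))
    cr′ : ∀ {x y} → x ∈ v ∷ L → y ∈ v ∷ L → t x ≡ true → t y ≡ false → r x y ≡ b
    cr′ (here refl) (here refl) tx ty = ⊥-elim (separates t tx ty refl)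
    cr′ (here refl) (there y∈) tx ty = joins y∈ (classOf y∈ ty (trans (sym (assign-self v bv s)) tx))
    cr′ (there x∈) (here refl) tx ty = trans (sym-r _ _) (joins x∈ (classOf x∈ tx (trans (sym (assign-self v bv s)) ty)))
    cr′ (there x∈) (there y∈) tx ty = cr x∈ y∈ (trans (sym (keep x∈)) tx) (trans (sym (keep y∈)) ty)

  apex : ∀ {L b v} → v ∉ L → ∀ {y} → y ∈ L → (∀ {z} → z ∈ L → r v z ≡ b) → Split r (v ∷ L) b
  apex {L} {b} {v} v∉L {y} y∈L related =
    split isV (v , here refl , dec-true (v ≟ v) refl) (y , there y∈L , dec-false (y ≟ v) (∉⇒≢ v∉L y∈L)) cr
    where
    isV : Fin m → Bool
    isV z = does (z ≟ v)
    cr : ∀ {x z} → x ∈ v ∷ L → z ∈ v ∷ L → isV x ≡ true → isV z ≡ false → r x z ≡ b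
    cr {x} _ _ ix _ with x ≟ v
    cr _ _           () _  | no _
    cr _ (here refl) _  iz | yes refl = ⊥-elim (separates isV {v} (dec-true (v ≟ v) refl) iz refl)
    cr _ (there z∈)  _  _  | yes refl = related z∈

  -- Let v ∉ L have a neighbour q in the false class and a non-neighbour x in
  -- the true class of a disconnected split of L.  Then the true-class
  -- non-neighbours of v are disconnected from the rest of v ∷ L: an edge from
  -- such a vertex a to a true-class neighbour c of v gives the induced P₄ a–c–v–q.
  refine : SymmetricRel r → InducedP4Free r → ∀ {L v} (sp : Split r L false) → v ∉ L →
           ∀ {q} → q ∈ L → side sp q ≡ false → r v q ≡ true →
           ∀ {x} → x ∈ L → side sp x ≡ true → r v x ≡ false → Split r (v ∷ L) false
  refine sym-r p4 {L} {v} (split s _ _ cr) v∉L {q} q∈ sq vq {x} x∈ sx vx =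
    split t (x , there x∈ , trans (keep x∈) (subst₂ (λ a c → a ∧ not c ≡ true) (sym sx) (sym vx) refl))
            (v , here refl , assign-self v false s₁) cr′
    where
    s₁ : Fin m → Bool
    s₁ z = s z ∧ not (r v z)
    t : Fin m → Bool
    t = assign v false s₁
    keep : ∀ {z} → z ∈ L → t z ≡ s₁ z
    keep z∈ = assign-other false s₁ (∉⇒≢ v∉L z∈)
    cut : ∀ {a c} → a ∈ L → c ∈ L → s a ≡ true → r v a ≡ false → s c ∧ not (r v c) ≡ false → r a c ≡ false
    cut {a} {c} a∈ c∈ sa va s₁c with s c in sc
    ... | false = cr a∈ c∈ sa sc
    ... | true with r v c in vc
    ...   | true with r a c in ac
    ...     | false = refl
    ...     | true = ⊥-elim (p4 a c v q
              ( (λ a≡c → separates (r v) vc va (sym a≡c)) , ∉⇒≢ v∉L a∈ , separates s sa sq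
              , ∉⇒≢ v∉L c∈ , separates s sc sq , ∉⇒≢ v∉L q∈ ∘ sym
              , ac , trans (sym-r c v) vc , vq
              , trans (sym-r a v) va , cr a∈ q∈ sa sq , cr c∈ q∈ sc sq ))
    cr′ : ∀ {y z} → y ∈ v ∷ L → z ∈ v ∷ L → t y ≡ true → t z ≡ false → r y z ≡ false
    cr′ (here refl) _ ty _ = ⊥-elim (separates t ty (assign-self v false s₁) refl)
    cr′ {y} (there y∈) z∈ ty tz with ∧-true {s y} (trans (sym (keep y∈)) ty)
    ... | sy , ¬vy with z∈
    ...   | here refl = trans (sym-r y v) (not-flip ¬vy)
    ...   | there z∈L = cut y∈ z∈L sy (not-flip ¬vy) (trans (sym (keep z∈L)) tz)

  -- Adding a vertex v to a disconnected split: v joins a class where it has no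
  -- neighbour, or splits off against L when related to all of it, or else refine applies.
  extend : SymmetricRel r → InducedP4Free r → ∀ {L v} → Split r L false → v ∉ L →
           Split r (v ∷ L) false ⊎ Split r (v ∷ L) true
  extend sym-r p4 {L} {v} sp v∉L
    with Any.any? (λ p → (side sp p ≟ᵇ true) ×-dec (r v p ≟ᵇ true)) L
       | Any.any? (λ q → (side sp q ≟ᵇ false) ×-dec (r v q ≟ᵇ true)) L
  ... | no noTrueNbr | _ =
    inj₁ (insert sym-r sp v∉L false λ y∈ sy → ¬-not λ vy → noTrueNbr (lose y∈ (sy , vy)))
  ... | yes _ | no noFalseNbr =
    inj₁ (insert sym-r sp v∉L true λ y∈ sy → ¬-not λ vy → noFalseNbr (lose y∈ (sy , vy)))
  ... | yes trueNbr | yes falseNbr with Any.any? (λ z → r v z ≟ᵇ false) L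
  ...   | no noNonNbr = inj₂ (apex v∉L (proj₁ (proj₂ (find trueNbr)))
                                  λ z∈ → ¬-not λ vz → noNonNbr (lose z∈ vz))
  ...   | yes nonNbr with find trueNbr | find falseNbr | find nonNbr
  ...     | p , p∈ , (sp-p , vp) | q , q∈ , (sp-q , vq) | x , x∈ , vx with side sp x in sx
  ...       | true  = inj₁ (refine sym-r p4 sp v∉L q∈ sp-q vq x∈ sx vx)
  ...       | false = inj₁ (refine sym-r p4 (flipSides sym-r sp) v∉L p∈ (cong not sp-p) vp x∈ (cong not sx) vx)

byValue : ∀ {m} {r : BRel m} {L b} → Split r L b → Split r L false ⊎ Split r L true
byValue {b = false} sp = inj₁ sp
byValue {b = true}  sp = inj₂ sp

decompose : ∀ {m} {r : BRel m} → SymmetricRel r → InducedP4Free r →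
            ∀ v w L → Unique (v ∷ w ∷ L) → Split r (v ∷ w ∷ L) false ⊎ Split r (v ∷ w ∷ L) true
decompose sym-r p4 v w [] ((v≢w ∷ []) ∷ _) =
  byValue (apex (λ { (here v≡w) → v≢w v≡w }) (here refl) λ { (here refl) → refl })
decompose sym-r p4 v w (u ∷ L) unique@(_ ∷ rest) with decompose sym-r p4 w u L rest
... | inj₁ disconnected = extend sym-r p4 disconnected (Unique[x∷xs]⇒x∉xs unique)
... | inj₂ coDisconnected =
  [ inj₂ ∘ fromComplement , inj₁ ∘ fromComplement ]
    (extend (complement-symmetric sym-r) (complement-P4Free sym-r p4) (toComplement coDisconnected) (Unique[x∷xs]⇒x∉xs unique))

ConnectedWithin : (G : Graph) → List (Fin (n G)) → Set
ConnectedWithin G L = ∀ {x y} → x ∈ L → y ∈ L → ∃ λ vs → IsPath G x y vs × All (_∈ L) vs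

walkStaysInClass : ∀ {G : Graph} {L} (sp : Split (adj G) L false) → ∀ x xs →
                   All (_∈ L) (x ∷ xs) → Consec (Adj G) (x ∷ xs) → side sp x ≡ true →
                   ∀ {y} → last (x ∷ xs) ≡ just y → side sp y ≡ true
walkStaysInClass sp x []       _                  _           sx refl = sx
walkStaysInClass {G} sp x (z ∷ xs) (x∈ ∷ z∈ ∷ inside) (xz , walk) sx end with side sp z in sz
... | true  = walkStaysInClass {G} sp z xs (z∈ ∷ inside) walk sz end
... | false with () ← trans (sym xz) (across sp x∈ z∈ sx sz)

noDisconnectedSplit : ∀ {G : Graph} {L} → ConnectedWithin G L → ¬ Split (adj G) L false
noDisconnectedSplit {G} conn sp with trueWit sp | falseWit sp
... | x , x∈ , sx | y , y∈ , sy with conn x∈ y∈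
...   | [] , (() , _) , _
...   | x′ ∷ xs , (refl , end , _ , walk) , inside =
  separates (side sp) (walkStaysInClass {G} sp x′ xs inside walk sx end) sy refl

joinSplit : ∀ G → P4Free G → ∀ L → ConnectedWithin G L → Unique L →
            ∀ {x y} → x ∈ L → y ∈ L → x ≢ y → Split (adj G) L true
joinSplit G p4 (v ∷ [])    _    _      (here refl) (here refl) x≢y = ⊥-elim (x≢y refl)
joinSplit G p4 (v ∷ w ∷ L) conn unique _ _ _ with decompose (Graph.sym G) p4 v w L unique
... | inj₁ disconnected = ⊥-elim (noDisconnectedSplit {G} conn disconnected)
... | inj₂ join         = join

others : ∀ {m} → Fin m → List (Fin m)
others d = filter (λ z → ¬? (z ≟ d)) (allFin _)

∈-others : ∀ {m} {d z : Fin m} → z ≢ d → z ∈ others d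
∈-others z≢d = ∈-filter⁺ (λ z → ¬? (z ≟ _)) (∈-allFin _) z≢d

others-≢ : ∀ {m} {d z : Fin m} → z ∈ others d → z ≢ d
others-≢ z∈ = proj₂ (∈-filter⁻ (λ z → ¬? (z ≟ _)) {xs = allFin _} z∈)

others-unique : ∀ {m} (d : Fin m) → Unique (others d)
others-unique {m} d = filter⁺ (λ z → ¬? (z ≟ d)) (allFin⁺ m)

∈-apex-others : ∀ {m} (d z : Fin m) → z ∈ d ∷ others d
∈-apex-others d z with z ≟ d
... | yes z≡d = here z≡d
... | no  z≢d = there (∈-others z≢d)

connected-all : ∀ {G} → Connected G → ConnectedWithin G (allFin (n G))
connected-all conn {x} {y} _ _ = proj₁ (conn x y) , proj₂ (conn x y) , All.tabulate λ _ → ∈-allFin _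

connected-others : ∀ {G} → TwoConnected G → ∀ d → ConnectedWithin G (others d)
connected-others (_ , _ , avoiding) d {x} {y} x∈ y∈ with avoiding d x y (others-≢ x∈) (others-≢ y∈)
... | vs , path , d∉vs = vs , path , All.tabulate λ z∈vs → ∈-others λ { refl → d∉vs z∈vs }

module _ {G : Graph} {q : ℕ} (c : Colouring G q) where

  properEdge : ∀ {u v} → u ≢ v → Adj G u v → ProperlyColouredPath c u v (u ∷ v ∷ [])
  properEdge u≢v uv = (refl , refl , ((u≢v ∷ []) ∷ [] ∷ []) , uv , tt) , tt

  proper₃ : ∀ {x₁ x₂ x₃} → x₁ ≢ x₂ → x₁ ≢ x₃ → x₂ ≢ x₃ → Adj G x₁ x₂ → Adj G x₂ x₃ →
            col c x₁ x₂ ≢ col c x₂ x₃ → ProperlyColouredPath c x₁ x₃ (x₁ ∷ x₂ ∷ x₃ ∷ [])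
  proper₃ n₁₂ n₁₃ n₂₃ e₁ e₂ c₁ =
    (refl , refl , ((n₁₂ ∷ n₁₃ ∷ []) ∷ (n₂₃ ∷ []) ∷ [] ∷ []) , e₁ , e₂ , tt) , c₁ , tt

  proper₅ : ∀ {x₁ x₂ x₃ x₄ x₅} →
            x₁ ≢ x₂ → x₁ ≢ x₃ → x₁ ≢ x₄ → x₁ ≢ x₅ → x₂ ≢ x₃ → x₂ ≢ x₄ → x₂ ≢ x₅ →
            x₃ ≢ x₄ → x₃ ≢ x₅ → x₄ ≢ x₅ →
            Adj G x₁ x₂ → Adj G x₂ x₃ → Adj G x₃ x₄ → Adj G x₄ x₅ →
            col c x₁ x₂ ≢ col c x₂ x₃ → col c x₂ x₃ ≢ col c x₃ x₄ → col c x₃ x₄ ≢ col c x₄ x₅ →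
            ProperlyColouredPath c x₁ x₅ (x₁ ∷ x₂ ∷ x₃ ∷ x₄ ∷ x₅ ∷ [])
  proper₅ n₁₂ n₁₃ n₁₄ n₁₅ n₂₃ n₂₄ n₂₅ n₃₄ n₃₅ n₄₅ e₁ e₂ e₃ e₄ c₁ c₂ c₃ =
    ( refl , refl
    , ((n₁₂ ∷ n₁₃ ∷ n₁₄ ∷ n₁₅ ∷ []) ∷ (n₂₃ ∷ n₂₄ ∷ n₂₅ ∷ []) ∷ (n₃₄ ∷ n₃₅ ∷ []) ∷ (n₄₅ ∷ []) ∷ [] ∷ [])
    , e₁ , e₂ , e₃ , e₄ , tt )
    , c₁ , c₂ , c₃ , tt

≡-≢ : ∀ {A : Set} {a b i j : A} → a ≡ i → b ≡ j → i ≢ j → a ≢ b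
≡-≢ a≡i b≡j i≢j a≡b = i≢j (trans (sym a≡i) (trans a≡b b≡j))

transportProper : ∀ {G q} {c c′ : Colouring G q} → (∀ x y → col c x y ≡ col c′ x y) →
                  ∀ {u v vs} → ProperlyColouredPath c u v vs → ProperlyColouredPath c′ u v vs
transportProper {c = c} {c′} same {vs = vs} (path , proper) = path , consecutive vs proper
  where
  consecutive : ∀ vs → Consec3 (λ x y z → col c x y ≢ col c y z) vs →
                Consec3 (λ x y z → col c′ x y ≢ col c′ y z) vs
  consecutive []               _          = tt
  consecutive (_ ∷ [])         _          = tt
  consecutive (_ ∷ _ ∷ [])     _          = tt
  consecutive (x ∷ y ∷ z ∷ vs) (xyz , rest) =
    (λ eq → xyz (trans (same x y) (trans eq (sym (same y z))))) , consecutive (y ∷ z ∷ vs) rest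

increasing : ∀ {m} → Fin m × Fin m → Bool
increasing p = toℕ (proj₁ p) <ᵇ toℕ (proj₂ p)

row : (m : ℕ) → Fin m → List (Fin m × Fin m)
row m i = filterᵇ increasing (map (λ j → (i , j)) (allFin m))

-- rows are disjoint since they have different first components; every listed pair
-- is increasing; hence pairs m has no repetitions
row-first : ∀ {m} i {p} → p ∈ row m i → proj₁ p ≡ i
row-first {m} i p∈ with ∈-map⁻ (λ j → (i , j)) (proj₁ (∈-filter⁻ (T? ∘ increasing) {xs = map (λ j → (i , j)) (allFin m)} p∈))
... | _ , _ , refl = refl

pairs-increasing : ∀ {m p} → p ∈ pairs m → toℕ (proj₁ p) < toℕ (proj₂ p)
pairs-increasing {m} {p} p∈ with find (∈-concatMap⁻ (row m) {xs = allFin m} p∈)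
... | i , _ , p∈row =
  <ᵇ⇒< (toℕ (proj₁ p)) (toℕ (proj₂ p)) (proj₂ (∈-filter⁻ (T? ∘ increasing) {xs = map (λ j → (i , j)) (allFin m)} p∈row))

pairs-unique : ∀ m → Unique (pairs m)
pairs-unique m =
  concat⁺ (All.map⁺ (All.tabulate λ _ → filter⁺ (T? ∘ increasing) (map⁺ (cong proj₂) (allFin⁺ m))))
          (AllPairs.map⁺ (AllPairs.map (λ i≢j {_} (p∈i , p∈j) → i≢j (trans (sym (row-first _ p∈i)) (row-first _ p∈j)))
                                       (allFin⁺ m)))

ordered : ∀ {m} → Fin m → Fin m → Fin m × Fin m
ordered x y = if toℕ x <ᵇ toℕ y then (x , y) else (y , x)

ordered-self : ∀ {m} {x y : Fin m} → toℕ x < toℕ y → (x , y) ≡ ordered x y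
ordered-self {x = x} {y} x<y with toℕ x <ᵇ toℕ y in x<ᵇy
... | true  = refl
... | false = ⊥-elim (subst T x<ᵇy (<⇒<ᵇ x<y))

ordered-swap : ∀ {m} {x y : Fin m} → toℕ x < toℕ y → (x , y) ≡ ordered y x
ordered-swap {x = x} {y} x<y with toℕ y <ᵇ toℕ x in y<ᵇx
... | false = refl
... | true  = ⊥-elim (<⇒≯ x<y (<ᵇ⇒< (toℕ y) (toℕ x) (subst T (sym y<ᵇx) tt)))

pattern one = suc zero
pattern two = suc (suc zero)

-- Colour of the edge between the vertices of rank i and j of the two classes
-- (rank 0: every vertex other than a₁, a₂, b₁, b₂): a₁b₁ ↦ 1 and a₁b₂, a₂b₁ ↦ 2.
edgeColour : Fin 3 → Fin 3 → Fin 3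
edgeColour one one = one
edgeColour one two = two
edgeColour two one = two
edgeColour _   _   = zero

edgeColour-sym : ∀ i j → edgeColour i j ≡ edgeColour j i
edgeColour-sym = toWitness {a? = all? λ i → all? λ j → edgeColour i j ≟ edgeColour j i} _

hubColours : ∀ i j → i ≢ j → edgeColour i one ≢ edgeColour one j
hubColours = toWitness {a? = all? λ i → all? λ j → ¬? (i ≟ j) →-dec ¬? (edgeColour i one ≟ edgeColour one j)} _

crossColour : Bool → Bool → Fin 3 → Fin 3 → Fin 3
crossColour true  false i j = edgeColour i j
crossColour false true  i j = edgeColour i j
crossColour _     _     _ _ = zero

crossColour-sym : ∀ b c i j → crossColour b c i j ≡ crossColour c b j i
crossColour-sym true  true  i j = refl
crossColour-sym true  false i j = edgeColour-sym i j
crossColour-sym false true  i j = edgeColour-sym i j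
crossColour-sym false false i j = refl

crossColour-within : ∀ b i j → crossColour b b i j ≡ zero
crossColour-within true  i j = refl
crossColour-within false i j = refl

crossColour-not : ∀ b c i j → crossColour (not b) (not c) i j ≡ crossColour b c i j
crossColour-not true  true  i j = refl
crossColour-not true  false i j = refl
crossColour-not false true  i j = refl
crossColour-not false false i j = refl

rank : ∀ {m} → Fin m → Fin m → Fin m → Fin 3
rank p q x = if does (x ≟ p) then one else if does (x ≟ q) then two else zero

rank-first : ∀ {m} (p q : Fin m) → rank p q p ≡ one
rank-first p q rewrite dec-true (p ≟ p) refl = refl

module _ {m : ℕ} {p q : Fin m} where

  rank-second : q ≢ p → rank p q q ≡ two
  rank-second q≢p rewrite dec-false (q ≟ p) q≢p | dec-true (q ≟ q) refl = refl

  rank-one : ∀ {x} → rank p q x ≡ one → x ≡ p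
  rank-one {x} rx with x ≟ p | x ≟ q
  rank-one _  | yes x≡p | _ = x≡p
  rank-one () | no _    | yes _
  rank-one () | no _    | no _

  rank-two : ∀ {x} → rank p q x ≡ two → x ≡ q
  rank-two {x} rx with x ≟ p | x ≟ q
  rank-two () | yes _ | _
  rank-two _  | no _  | yes x≡q = x≡q
  rank-two () | no _  | no _

  sameRank⇒unnamed : ∀ {x y} → rank p q x ≡ rank p q y → x ≢ y → rank p q x ≡ zero
  sameRank⇒unnamed {x} {y} same x≢y with rank p q x in rx
  ... | zero = refl
  ... | one  = ⊥-elim (x≢y (trans (rank-one rx) (sym (rank-one (sym same)))))
  ... | two  = ⊥-elim (x≢y (trans (rank-two rx) (sym (rank-two (sym same)))))

  unnamed≢first : ∀ {x} → rank p q x ≡ zero → x ≢ p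
  unnamed≢first rx refl with () ← trans (sym rx) (rank-first p q)

record BalancedJoin (G : Graph) : Set where
  field
    part     : Fin (n G) → Bool
    join     : ∀ {x y} → part x ≡ true → part y ≡ false → Adj G x y
    a₁ a₂ b₁ b₂ : Fin (n G)
    a₁-true  : part a₁ ≡ true
    a₂-true  : part a₂ ≡ true
    b₁-false : part b₁ ≡ false
    b₂-false : part b₂ ≡ false
    a₁≢a₂    : a₁ ≢ a₂
    b₁≢b₂    : b₁ ≢ b₂

  join′ : ∀ {x y} → part x ≡ false → part y ≡ true → Adj G x y
  join′ {x} {y} px py = trans (Graph.sym G x y) (join py px)

  classRank : Fin (n G) → Fin 3
  classRank x = if part x then rank a₁ a₂ x else rank b₁ b₂ x

  colouring : Colouring G 2
  colouring = record
    { col    = λ x y → crossColour (part x) (part y) (classRank x) (classRank y)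
    ; colSym = λ x y → crossColour-sym (part x) (part y) (classRank x) (classRank y) }

swap : ∀ {G} → BalancedJoin G → BalancedJoin G
swap J = record
  { part = not ∘ part ; join = λ px py → join′ (not-flip px) (not-flip py)
  ; a₁ = b₁ ; a₂ = b₂ ; b₁ = a₁ ; b₂ = a₂
  ; a₁-true = cong not b₁-false ; a₂-true = cong not b₂-false
  ; b₁-false = cong not a₁-true ; b₂-false = cong not a₂-true
  ; a₁≢a₂ = b₁≢b₂ ; b₁≢b₂ = a₁≢a₂ }
  where open BalancedJoin J

swap-colouring : ∀ {G} (J : BalancedJoin G) x y →
                 col (BalancedJoin.colouring (swap J)) x y ≡ col (BalancedJoin.colouring J) x y
swap-colouring J x y =
  trans (cong₂ (crossColour (not (part x)) (not (part y))) (swapRank x) (swapRank y))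
        (crossColour-not (part x) (part y) _ _)
  where
  open BalancedJoin J
  swapRank : ∀ z → BalancedJoin.classRank (swap J) z ≡ classRank z
  swapRank z with part z
  ... | true  = refl
  ... | false = refl

module _ {G : Graph} (J : BalancedJoin G) where
  open BalancedJoin J

  colourAcross : ∀ {x y} → part x ≡ true → part y ≡ false →
                 col colouring x y ≡ edgeColour (rank a₁ a₂ x) (rank b₁ b₂ y)
  colourAcross px py rewrite px | py = refl

  colourAcross′ : ∀ {x y} → part x ≡ false → part y ≡ true →
                  col colouring x y ≡ edgeColour (rank b₁ b₂ x) (rank a₁ a₂ y)
  colourAcross′ px py rewrite px | py = refl

  data Classes (x y : Fin (n G)) : Set where
    trueFalse   : part x ≡ true  → part y ≡ false → Classes x y
    falseTrue   : part x ≡ false → part y ≡ true  → Classes x y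
    bothTrue    : part x ≡ true  → part y ≡ true  → Classes x y
    bothFalse   : part x ≡ false → part y ≡ false → Classes x y

  classes : ∀ x y → Classes x y
  classes x y with part x in px | part y in py
  ... | true  | false = trueFalse px py
  ... | false | true  = falseTrue px py
  ... | true  | true  = bothTrue px py
  ... | false | false = bothFalse px py

  colourWithin : ∀ {x y} → part x ≡ part y → col colouring x y ≡ zero
  colourWithin {x} {y} same =
    subst (λ b → crossColour (part x) b (classRank x) (classRank y) ≡ zero) same (crossColour-within (part x) _ _)

  -- Distinct vertices u, v of the true class are joined through the hub b₁ when
  -- their ranks differ; otherwise both are unnamed and u b₁ a₁ b₂ v has colours 0, 1, 2, 0.
  firstClassPath : ∀ {u v} → part u ≡ true → part v ≡ true → u ≢ v →
                   ∃ λ vs → ProperlyColouredPath colouring u v vs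
  firstClassPath {u} {v} pu pv u≢v with rank a₁ a₂ u ≟ rank a₁ a₂ v
  ... | no ranks≢ =
    _ , proper₃ colouring (separates part pu b₁-false) u≢v (separates part pv b₁-false ∘ sym)
                (join pu b₁-false) (join′ b₁-false pv) throughHub
    where
    throughHub : col colouring u b₁ ≢ col colouring b₁ v
    throughHub rewrite colourAcross pu b₁-false | colourAcross′ b₁-false pv | rank-first b₁ b₂ =
      hubColours _ _ ranks≢
  ... | yes ranks≡ =
    _ , proper₅ colouring
          (separates part pu b₁-false) (unnamed≢first ru) (separates part pu b₂-false) u≢v
          (separates part a₁-true b₁-false ∘ sym) b₁≢b₂ (separates part pv b₁-false ∘ sym)
          (separates part a₁-true b₂-false) (unnamed≢first rv ∘ sym) (separates part pv b₂-false ∘ sym)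
          (join pu b₁-false) (join′ b₁-false a₁-true) (join a₁-true b₂-false) (join′ b₂-false pv)
          (≡-≢ ub₁ b₁a₁ λ ()) (≡-≢ b₁a₁ a₁b₂ λ ()) (≡-≢ a₁b₂ b₂v λ ())
    where
    ru : rank a₁ a₂ u ≡ zero
    ru = sameRank⇒unnamed ranks≡ u≢v
    rv : rank a₁ a₂ v ≡ zero
    rv = sameRank⇒unnamed (sym ranks≡) (u≢v ∘ sym)
    ub₁ : col colouring u b₁ ≡ zero
    ub₁ = trans (colourAcross pu b₁-false) (cong₂ edgeColour ru (rank-first b₁ b₂))
    b₁a₁ : col colouring b₁ a₁ ≡ one
    b₁a₁ = trans (colourAcross′ b₁-false a₁-true) (cong₂ edgeColour (rank-first b₁ b₂) (rank-first a₁ a₂))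
    a₁b₂ : col colouring a₁ b₂ ≡ two
    a₁b₂ = trans (colourAcross a₁-true b₂-false) (cong₂ edgeColour (rank-first a₁ a₂) (rank-second (b₁≢b₂ ∘ sym)))
    b₂v : col colouring b₂ v ≡ zero
    b₂v = trans (colourAcross′ b₂-false pv) (cong₂ edgeColour (rank-second (b₁≢b₂ ∘ sym)) rv)

  recolouredEdges : List (Fin (n G) × Fin (n G))
  recolouredEdges = ordered a₁ b₁ ∷ ordered a₁ b₂ ∷ ordered a₂ b₁ ∷ []

  recolouredAcross : ∀ {x y} → part x ≡ true → part y ≡ false →
                     isNonZero (col colouring x y) ≡ true → ordered x y ∈ recolouredEdges
  recolouredAcross {x} {y} px py nz =
    byRanks _ _ refl refl (subst (λ c → isNonZero c ≡ true) (colourAcross px py) nz)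
    where
    byRanks : ∀ i j → rank a₁ a₂ x ≡ i → rank b₁ b₂ y ≡ j → isNonZero (edgeColour i j) ≡ true →
              ordered x y ∈ recolouredEdges
    byRanks one  one  rx ry _ = here (cong₂ ordered (rank-one rx) (rank-one ry))
    byRanks one  two  rx ry _ = there (here (cong₂ ordered (rank-one rx) (rank-two ry)))
    byRanks two  one  rx ry _ = there (there (here (cong₂ ordered (rank-two rx) (rank-one ry))))
    byRanks zero _    _  _  ()
    byRanks one  zero _  _  ()
    byRanks two  zero _  _  ()
    byRanks two  two  _  _  ()

  recolouredPair : ∀ {x y} → toℕ x < toℕ y → isNonZero (col colouring x y) ≡ true → (x , y) ∈ recolouredEdges
  recolouredPair {x} {y} x<y nz with classes x y
  ... | trueFalse px py = subst (_∈ recolouredEdges) (sym (ordered-self x<y)) (recolouredAcross px py nz)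
  ... | falseTrue px py = subst (_∈ recolouredEdges) (sym (ordered-swap x<y))
                          (recolouredAcross py px (trans (cong isNonZero (colSym colouring y x)) nz))
  ... | bothTrue  px py with () ← trans (sym nz) (cong isNonZero (colourWithin (trans px (sym py))))
  ... | bothFalse px py with () ← trans (sym nz) (cong isNonZero (colourWithin (trans px (sym py))))

  atMostThreeRecoloured : recoloured colouring ≤ 3
  atMostThreeRecoloured =
    unique-⊆⇒length≤ (filter⁺ (T? ∘ isRecoloured) (pairs-unique (n G)))
      (All.tabulate λ p∈ →
        let p∈pairs , chosen = ∈-filter⁻ (T? ∘ isRecoloured) {xs = pairs (n G)} p∈
        in recolouredPair (pairs-increasing p∈pairs) (proj₂ (∧-true (Equivalence.to T-≡ chosen))))
    where
    isRecoloured : Fin (n G) × Fin (n G) → Bool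
    isRecoloured (x , y) = adj G x y ∧ isNonZero (col colouring x y)

-- Any two distinct vertices are properly connected: adjacent ones by their edge,
-- others lie in one class, and the false class is the true class of swap J.
properlyConnected : ∀ {G} (J : BalancedJoin G) → ProperlyConnected (BalancedJoin.colouring J)
properlyConnected {G} J u v u≢v with adj G u v in uv | classes J u v
... | true  | _ = _ , properEdge (BalancedJoin.colouring J) u≢v uv
... | false | trueFalse pu pv with () ← trans (sym (BalancedJoin.join J pu pv)) uv
... | false | falseTrue pu pv with () ← trans (sym (BalancedJoin.join′ J pu pv)) uv
... | false | bothTrue  pu pv = firstClassPath J pu pv u≢v
... | false | bothFalse pu pv =
  let vs , path = firstClassPath (swap J) (cong not pu) (cong not pv) u≢v
  in vs , transportProper {c = BalancedJoin.colouring (swap J)} {c′ = BalancedJoin.colouring J}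
                          (swap-colouring J) path

balancedJoin⇒pcOpt≤5 : ∀ {G} → BalancedJoin G → PcOptAtMost G 5
balancedJoin⇒pcOpt≤5 J =
  2 , BalancedJoin.colouring J , properlyConnected J , +-monoˡ-≤ 2 (atMostThreeRecoloured J)

balancedFromSplit : ∀ G {L} (sp : Split (adj G) L true) → (∀ z → z ∈ L) →
                    ∀ {a₁ a₂ b₁ b₂} → side sp a₁ ≡ true → side sp a₂ ≡ true →
                    side sp b₁ ≡ false → side sp b₂ ≡ false → a₁ ≢ a₂ → b₁ ≢ b₂ → BalancedJoin G
balancedFromSplit G sp everywhere {a₁} {a₂} {b₁} {b₂} pa₁ pa₂ pb₁ pb₂ a₁≢a₂ b₁≢b₂ = record
  { part = side sp ; join = across sp (everywhere _) (everywhere _)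
  ; a₁ = a₁ ; a₂ = a₂ ; b₁ = b₁ ; b₂ = b₂
  ; a₁-true = pa₁ ; a₂-true = pa₂ ; b₁-false = pb₁ ; b₂-false = pb₂
  ; a₁≢a₂ = a₁≢a₂ ; b₁≢b₂ = b₁≢b₂ }

soleIsDominating : ∀ G {L} (sp : Split (adj G) L true) → (∀ z → z ∈ L) →
                   ∀ {d} → side sp d ≡ true → (∀ x → side sp x ≡ true → x ≡ d) →
                   ∀ w → w ≢ d → Adj G d w
soleIsDominating G sp everywhere pd sole w w≢d =
  across sp (everywhere _) (everywhere _) pd (¬-not λ pw → w≢d (sole w pw))

addDominating : ∀ G {d} → (∀ w → w ≢ d → Adj G d w) → (sp : Split (adj G) (others d) true) →
                ∀ {a b b′} → a ∈ others d → side sp a ≡ true → b ∈ others d → side sp b ≡ false →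
                b′ ∈ others d → side sp b′ ≡ false → b ≢ b′ → BalancedJoin G
addDominating G {d} dominating sp a∈ pa b∈ pb b′∈ pb′ b≢b′ =
  balancedFromSplit G whole (∈-apex-others d) (assign-self d true (side sp))
    (trans (keep a∈) pa) (trans (keep b∈) pb) (trans (keep b′∈) pb′) (others-≢ a∈ ∘ sym) b≢b′
  where
  whole : Split (adj G) (d ∷ others d) true
  whole = insert (Graph.sym G) sp (λ d∈ → others-≢ d∈ refl) true λ y∈ _ → dominating _ (others-≢ y∈)
  keep : ∀ {z} → z ∈ others d → side whole z ≡ side sp z
  keep z∈ = assign-other true (side sp) (others-≢ z∈)

-- If d dominates G, then G - d is connected (G is 2-connected), hence a join X + Y.
-- Adding d to Y, or to X, gives a balanced join as soon as X, or Y, has two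
-- vertices, and one of them does since G has at least four vertices.
dominatingCase : ∀ G → TwoConnected G → P4Free G → 4 ≤ order G →
                 ∀ d → (∀ w → w ≢ d → Adj G d w) → PcOptAtMost G 5
dominatingCase G tc p4 4≤n d dominating
  with twoMissing (d ∷ []) (≤-trans (n≤1+n 3) 4≤n)
... | z₁ , z₂ , z₁∉ , z₂∉ , z₁≢z₂
  with joinSplit G p4 (others d) (connected-others {G} tc d) (others-unique d)
                 (∈-others (z₁∉ ∘ here)) (∈-others (z₂∉ ∘ here)) z₁≢z₂
... | sp with trueWit sp | falseWit sp
... | x₀ , x₀∈ , px₀ | y₀ , y₀∈ , py₀
  with secondOrSole (λ x → (side sp x ≟ᵇ true) ×-dec ¬? (x ≟ d)) x₀
     | secondOrSole (λ y → (side sp y ≟ᵇ false) ×-dec ¬? (y ≟ d)) y₀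
... | inj₁ (x′ , (px′ , x′≢d) , x′≢x₀) | _ =
  balancedJoin⇒pcOpt≤5 (addDominating G dominating (flipSides (Graph.sym G) sp)
    y₀∈ (cong not py₀) x₀∈ (cong not px₀) (∈-others x′≢d) (cong not px′) (x′≢x₀ ∘ sym))
... | _ | inj₁ (y′ , (py′ , y′≢d) , y′≢y₀) =
  balancedJoin⇒pcOpt≤5 (addDominating G dominating sp x₀∈ px₀ y₀∈ py₀ (∈-others y′≢d) py′ (y′≢y₀ ∘ sym))
... | inj₂ soleX | inj₂ soleY with missingVertex (d ∷ x₀ ∷ y₀ ∷ []) 4≤n
...   | z , z∉ with side sp z in pz
...     | true  = ⊥-elim (z∉ (there (here (soleX z (pz , z∉ ∘ here)))))
...     | false = ⊥-elim (z∉ (there (there (here (soleY z (pz , z∉ ∘ here))))))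

twoConnected-P4Free⇒pcOpt≤5 : ∀ G → TwoConnected G → P4Free G → 4 ≤ order G → PcOptAtMost G 5
twoConnected-P4Free⇒pcOpt≤5 G tc p4 4≤n
  with twoMissing [] (≤-trans (n≤1+n 2) (≤-trans (n≤1+n 3) 4≤n))
... | z₁ , z₂ , _ , _ , z₁≢z₂
  with joinSplit G p4 (allFin (n G)) (connected-all {G} (proj₁ (proj₂ tc))) (allFin⁺ (n G))
                 (∈-allFin z₁) (∈-allFin z₂) z₁≢z₂
... | sp with trueWit sp | falseWit sp
... | a₀ , _ , pa₀ | b₀ , _ , pb₀
  with secondOrSole (λ x → side sp x ≟ᵇ true) a₀ | secondOrSole (λ y → side sp y ≟ᵇ false) b₀
... | inj₂ soleA | _ = dominatingCase G tc p4 4≤n a₀ (soleIsDominating G sp ∈-allFin pa₀ soleA)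
... | _ | inj₂ soleB =
  dominatingCase G tc p4 4≤n b₀
    (soleIsDominating G (flipSides (Graph.sym G) sp) ∈-allFin (cong not pb₀) λ x px → soleB x (not-flip px))
... | inj₁ (a′ , pa′ , a′≢a₀) | inj₁ (b′ , pb′ , b′≢b₀) =
  balancedJoin⇒pcOpt≤5 (balancedFromSplit G sp ∈-allFin pa₀ pa′ pb₀ pb′ (a′≢a₀ ∘ sym) (b′≢b₀ ∘ sym))

corollary8 : (G : Graph) → TwoConnected G → P4Free G → 9 ≤ order G → PcOptAtMost G 5
corollary8 G tc p4 9≤n = twoConnected-P4Free⇒pcOpt≤5 G tc p4 (≤-trans (s≤s (s≤s (s≤s (s≤s z≤n)))) 9≤n)
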